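{- For every $n\ge 1$, the map $\varphi:\mathcal{I}_n(213)\to G_n$ given by $\varphi(\iota)=\mathrm{Des}(\iota)$ is well defined (i.e. $\mathrm{Des}(\iota)\in G_n$) and is a bijection.
   Context: A permutation $\sigma$ of $[n]$ (one-line notation) contains a pattern $\pi\in\mathfrak{S}_k$ if some subsequence $\sigma(m_1)\cdots\sigma(m_k)$ with $m_1<\dots<m_k$ is in the same relative order as $\pi$; otherwise it avoids $\pi$. $\mathcal{I}_n(\pi)$ is the set of involutions ($\iota^2=\mathrm{id}$) of $[n]$ avoiding $\pi$. $\mathrm{Des}(\sigma)=\{i\in[n-1]:\sigma(i)>\sigma(i+1)\}$. $G_n$ is the set of subsets $A=\{a_1<a_2<\dots<a_\ell\}\subseteq[n-1]$ (including the empty set) such that $a_i+a_{\ell-i+1}\ge n$ for all $i\in[\ell]$. -}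

module Defs where

open import Data.Nat using (ℕ; zero; suc; _+_; _≤_)
open import Data.Fin using (Fin; inject₁; toℕ) renaming (_<_ to _<ᶠ_; _<?_ to _<ᶠ?_)
open import Data.Fin.Permutation using (Permutation′; _⟨$⟩ʳ_)
open import Data.Fin.Subset using (Subset)
open import Data.Vec using (Vec; []; _∷_; tabulate)
open import Data.Bool using (Bool; true; false)
open import Data.List using (List; []; _∷_; map; zip; reverse)
open import Data.List.Relation.Unary.All using (All)
open import Data.Product using (_×_; _,_; ∃-syntax)
open import Relation.Binary.PropositionalEquality using (_≡_)
open import Relation.Nullary using (¬_)
open import Relation.Nullary.Decidable using (⌊_⌋)

-- permutations of [n] (positions/values are 0-indexed Fin n)
Perm : ℕ → Set
Perm n = Permutation′ n

IsInvolution : ∀ {n} → Perm n → Set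
IsInvolution σ = ∀ i → σ ⟨$⟩ʳ (σ ⟨$⟩ʳ i) ≡ i

Contains213 : ∀ {n} → Perm n → Set
Contains213 {n} σ = ∃[ i ] ∃[ j ] ∃[ k ]
  (i <ᶠ j × j <ᶠ k × (σ ⟨$⟩ʳ j) <ᶠ (σ ⟨$⟩ʳ i) × (σ ⟨$⟩ʳ i) <ᶠ (σ ⟨$⟩ʳ k))

Avoids213 : ∀ {n} → Perm n → Set
Avoids213 σ = ¬ Contains213 σ

-- Subsets of [n-1] for n = suc m: a : Fin m stands for the element toℕ a + 1.
-- Des σ ⊆ [n-1]: 1-indexed position toℕ a + 1 is a descent iff σ(a) > σ(a+1) (0-indexed).
Des : ∀ {m} → Perm (suc m) → Subset m
Des σ = tabulate (λ a → ⌊ (σ ⟨$⟩ʳ Fin.suc a) <ᶠ? (σ ⟨$⟩ʳ inject₁ a) ⌋)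

elems : ∀ {m} → Subset m → List ℕ
elems [] = []
elems (true ∷ p) = 1 ∷ map suc (elems p)
elems (false ∷ p) = map suc (elems p)

-- A = {a_1<...<a_l} ∈ G_n  iff  a_i + a_{l-i+1} ≥ n for all i
InG : (n : ℕ) → ∀ {m} → Subset m → Set
InG n A = All (λ { (x , y) → n ≤ x + y }) (zip (elems A) (reverse (elems A)))

module Submission where

-- We work with functions g : ℕ → ℕ that are 213-avoiding involutions of an
-- initial segment [0, n) (Inv213) and with descent words (lists of
-- booleans).  The engine is a recursive decomposition.  If g is such an
-- involution of [0, m+2), either its maximum m+1 is a fixed point, and then
-- g is the identity (fixed-max⇒identity), or the maximum sits at a position
-- f ≤ m; then g is obtained from a 213-avoiding involution g° of [0, m)
-- which increases on [0, f) by inserting the 2-cycle (f, m+1) (extend,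
-- Extension, Restriction).  The descent word of such an extension is
-- 0^f 1 u c while that of g° is reducedWord f u c (extension-desWord,
-- restriction-desWord), and the G_n condition on the positions of the
-- letters 1 (Balanced) holds for one word iff it holds for the other
-- (balanced-extension).  Induction on n then shows that descent words are
-- balanced (desWord-balanced), determine the involution
-- (desWord-injective), and that every balanced word occurs
-- (desWord-surjective).  Finally these facts are transported to
-- permutations of Fin n and to subsets of [n-1].

open import Defs
open import Data.Nat using (ℕ; zero; suc; _+_; _∸_; _≤_; _<_; z≤n; s≤s; pred; _<?_; _≤?_)
open import Data.Nat.Properties
open import Data.Bool using (Bool; true; false)
open import Data.Empty using (⊥; ⊥-elim)
open import Data.Sum using (inj₁; inj₂)
open import Data.Product using (Σ; _×_; _,_; proj₁; proj₂; ∃-syntax)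
import Data.Product as Product
open import Data.List using (List; []; _∷_; _++_; _∷ʳ_; replicate; length; map; zip; reverse; reverseAcc;
  initLast; _∷ʳ′_)
open import Data.List.Properties
  using (∷-injectiveˡ; ∷-injectiveʳ; map-id; map-∘; map-++; reverse-map; zip-map; map-cong; unfold-reverse;
         reverse-++; length-reverse; length-++; length-replicate; ++-cancelˡ; ∷ʳ-injective)
open import Data.List.Relation.Unary.All using (All; []; _∷_) renaming (map to allMap)
open import Data.List.Relation.Unary.All.Properties using (map⁺; map⁻; ++⁺; ++⁻ˡ)
open import Data.Fin using (Fin; toℕ; fromℕ<; inject₁)
open import Data.Fin.Properties using (toℕ-fromℕ<; fromℕ<-toℕ; toℕ<n; toℕ-injective; toℕ-inject₁)
open import Data.Fin.Permutation using (_⟨$⟩ʳ_; permutation)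
open import Data.Fin.Subset using (Subset)
open import Data.Vec using ([]; _∷_; tabulate; toList)
open import Data.Vec.Properties using (length-toList; toList-injective)
open import Data.Vec.Relation.Binary.Equality.Cast using (cast-is-id)
open import Function using (_∘_)
open import Function.Bundles using (_⇔_; mk⇔; Equivalence)
open import Relation.Nullary using (¬_; yes; no)
open import Relation.Nullary.Decidable using (⌊_⌋)
open import Relation.Nullary.Negation using (contradiction)
open import Relation.Binary.PropositionalEquality
open import Relation.Binary.Definitions using (tri<; tri≈; tri>)

-- A function g : ℕ → ℕ "is a 213-avoiding involution of [0, n)" when it maps
-- [0, n) into itself, is involutive there, and has no positions i < j < k < n
-- with g j < g i < g k.  Working with plain functions on ℕ keeps the
-- recursive constructions below free of Fin bookkeeping.
record Inv213 (n : ℕ) (g : ℕ → ℕ) : Set where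
  field
    bounded    : ∀ {x} → x < n → g x < n
    involutive : ∀ {x} → x < n → g (g x) ≡ x
    avoids     : ∀ {i j k} → i < j → j < k → k < n → g j < g i → g i < g k → ⊥
open Inv213 public

inv213-injective : ∀ {n g} → Inv213 n g → ∀ {x y} → x < n → y < n → g x ≡ g y → x ≡ y
inv213-injective {g = g} I {x} {y} x<n y<n e =
  trans (sym (involutive I x<n)) (trans (cong g e) (involutive I y<n))

id-inv213 : ∀ n → Inv213 n (λ x → x)
id-inv213 n = record
  { bounded = λ p → p ; involutive = λ _ → refl ; avoids = λ i<j _ _ j<i _ → <-asym i<j j<i }

IncreasingBelow : ℕ → (ℕ → ℕ) → Set
IncreasingBelow f h = ∀ {x y} → x < y → y < f → h x < h y

-- The maximal value n' of an involution g of [0, n'+1) sits at position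
-- top = g n'.  Avoiding 213 forces g to increase up to top (a descent
-- before top together with the maximum would form a 213), and top is
-- followed by a descent.
module MaxValue {n' : ℕ} {g : ℕ → ℕ} (I : Inv213 (suc n') g) where
  top : ℕ
  top = g n'

  top<n : top < suc n'
  top<n = bounded I ≤-refl

  g-top : g top ≡ n'
  g-top = involutive I ≤-refl

  below-max : ∀ {x} → x < suc n' → x ≢ top → g x < n'
  below-max {x} x<n x≢top = ≤∧≢⇒< (≤-pred (bounded I x<n))
    (λ e → x≢top (inv213-injective I x<n top<n (trans e (sym g-top))))

  increasing-to-top : ∀ {x y} → x < y → y ≤ top → g x < g y
  increasing-to-top {x} {y} x<y y≤top with m≤n⇒m<n∨m≡n y≤top
  ... | inj₂ refl = subst (g x <_) (sym g-top) (below-max (<-trans x<y top<n) (<⇒≢ x<y))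
  ... | inj₁ y<top with <-cmp (g x) (g y)
  ...   | tri< gx<gy _ _ = gx<gy
  ...   | tri≈ _ e _ = contradiction (inv213-injective I x<n y<n e) (<⇒≢ x<y)
    where y<n = <-trans y<top top<n
          x<n = <-trans x<y y<n
  ...   | tri> _ _ gy<gx = ⊥-elim (avoids I x<y y<top top<n gy<gx gx<max)
    where gx<max : g x < g top
          gx<max = subst (g x <_) (sym g-top)
            (below-max (<-trans x<y (<-trans y<top top<n)) (<⇒≢ (<-trans x<y y<top)))

  descent-after-top : suc top < suc n' → g (suc top) < g top
  descent-after-top st<n =
    subst (g (suc top) <_) (sym g-top) (below-max st<n (λ e → <-irrefl (sym e) (n<1+n top)))

-- If the maximum is a fixed point, the involution is the identity: g is
-- increasing on all of [0, n'+1), and an increasing involution is trivial.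
fixed-max⇒identity : ∀ {n' g} → Inv213 (suc n') g → g n' ≡ n' → ∀ {x} → x < suc n' → g x ≡ x
fixed-max⇒identity {n'} {g} I e {x} x<n with <-cmp (g x) x
... | tri≈ _ gx≡x _ = gx≡x
... | tri< gx<x _ _ = ⊥-elim (<-asym gx<x
      (subst (_< g x) (involutive I x<n) (increasing-to-top gx<x (subst (x ≤_) (sym e) (≤-pred x<n)))))
  where open MaxValue I
... | tri> _ _ x<gx = ⊥-elim (<-asym x<gx
      (subst (g x <_) (involutive I x<n)
        (increasing-to-top x<gx (subst (g x ≤_) (sym e) (≤-pred (bounded I x<n))))))
  where open MaxValue I

-- Descent words.  descentAt g a records whether a+1 (1-indexed) is a
-- descent of g, descents g s l lists these letters for a = s, …, s+l-1,
-- and desWord n g is the descent word of g on [0, n), of length n-1.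
descentAt : (ℕ → ℕ) → ℕ → Bool
descentAt g a = ⌊ g (suc a) <? g a ⌋

descents : (ℕ → ℕ) → ℕ → ℕ → List Bool
descents g s zero = []
descents g s (suc l) = descentAt g s ∷ descents g (suc s) l

desWord : ℕ → (ℕ → ℕ) → List Bool
desWord n g = descents g 0 (pred n)

module _ {g : ℕ → ℕ} {a : ℕ} where
  descentAt-true : g (suc a) < g a → descentAt g a ≡ true
  descentAt-true p with g (suc a) <? g a
  ... | yes _ = refl
  ... | no q = contradiction p q

  descentAt-false : ¬ g (suc a) < g a → descentAt g a ≡ false
  descentAt-false p with g (suc a) <? g a
  ... | yes q = contradiction q p
  ... | no _ = refl

  descentAt-false⁻ : descentAt g a ≡ false → ¬ g (suc a) < g a
  descentAt-false⁻ e with g (suc a) <? g a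
  ... | no q = q

descentAt-cong : ∀ {g h a b} → (g (suc a) < g a ⇔ h (suc b) < h b) → descentAt g a ≡ descentAt h b
descentAt-cong {g} {h} {a} {b} g⇔h with h (suc b) <? h b
... | yes r = descentAt-true {g} {a} (Equivalence.from g⇔h r)
... | no r = descentAt-false {g} {a} (λ z → r (Equivalence.to g⇔h z))

descents-length : ∀ g s l → length (descents g s l) ≡ l
descents-length g s zero = refl
descents-length g s (suc l) = cong suc (descents-length g (suc s) l)

descents-++ : ∀ g s a b → descents g s (a + b) ≡ descents g s a ++ descents g (s + a) b
descents-++ g s zero b = cong (λ z → descents g z b) (sym (+-identityʳ s))
descents-++ g s (suc a) b = cong (descentAt g s ∷_)
  (trans (descents-++ g (suc s) a b) (cong (λ z → descents g (suc s) a ++ descents g z b) (sym (+-suc s a))))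

descents-cong : ∀ {g h} s s' l → (∀ a → a < l → descentAt g (s + a) ≡ descentAt h (s' + a)) →
                descents g s l ≡ descents h s' l
descents-cong s s' zero p = refl
descents-cong {g} {h} s s' (suc l) p = cong₂ _∷_
  (subst₂ (λ x y → descentAt g x ≡ descentAt h y) (+-identityʳ s) (+-identityʳ s') (p 0 (s≤s z≤n)))
  (descents-cong (suc s) (suc s') l
    (λ a a<l → subst₂ (λ x y → descentAt g x ≡ descentAt h y) (+-suc s a) (+-suc s' a) (p (suc a) (s≤s a<l))))

descents-ascending : ∀ {g} s l → (∀ a → a < l → descentAt g (s + a) ≡ false) → descents g s l ≡ replicate l false
descents-ascending s zero p = refl
descents-ascending {g} s (suc l) p = cong₂ _∷_
  (subst (λ x → descentAt g x ≡ false) (+-identityʳ s) (p 0 (s≤s z≤n)))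
  (descents-ascending (suc s) l (λ a a<l → subst (λ x → descentAt g x ≡ false) (+-suc s a) (p (suc a) (s≤s a<l))))

descents-ext : ∀ {g h} s l → (∀ x → x ≤ s + l → g x ≡ h x) → descents g s l ≡ descents h s l
descents-ext s zero p = refl
descents-ext {g} {h} s (suc l) p = cong₂ _∷_
  (descentAt-cong {g} {h} {s} {s} (mk⇔ (subst₂ _<_ (p (suc s) s+1≤) (p s s≤))
                                      (subst₂ _<_ (sym (p (suc s) s+1≤)) (sym (p s s≤)))))
  (descents-ext (suc s) l (λ x x≤ → p x (subst (x ≤_) (sym (+-suc s l)) x≤)))
  where
  s≤ : s ≤ s + suc l
  s≤ = m≤m+n s (suc l)
  s+1≤ : suc s ≤ s + suc l
  s+1≤ = subst (suc s ≤_) (sym (+-suc s l)) (s≤s (m≤m+n s l))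

descents-prefix : ∀ {g} s l j r → descents g s l ≡ replicate j false ++ r →
                  ∀ a → a < j → descentAt g (s + a) ≡ false
descents-prefix s zero (suc j) r () a a<j
descents-prefix {g} s (suc l) (suc j) r e zero a<j =
  trans (cong (descentAt g) (+-identityʳ s)) (∷-injectiveˡ e)
descents-prefix {g} s (suc l) (suc j) r e (suc a) (s≤s a<j) =
  trans (cong (descentAt g) (+-suc s a)) (descents-prefix (suc s) l j r (∷-injectiveʳ e) a a<j)

increasing-from-ascents : ∀ {m g} → Inv213 m g → ∀ f → f ≤ m →
                          (∀ a → suc a < f → descentAt g a ≡ false) → IncreasingBelow f g
increasing-from-ascents {m} {g} I f f≤m asc = increasing
  where
  step : ∀ a → suc a < f → g a < g (suc a)
  step a sa<f with <-cmp (g a) (g (suc a))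
  ... | tri< lt _ _ = lt
  ... | tri≈ _ e _ = contradiction (inv213-injective I (<-trans (n<1+n a) (<-≤-trans sa<f f≤m)) (<-≤-trans sa<f f≤m) e)
                                   (<⇒≢ (n<1+n a))
  ... | tri> _ _ gt = contradiction gt (descentAt-false⁻ {g} {a} (asc a sa<f))
  increasing : IncreasingBelow f g
  increasing {x} {suc y} (s≤s x≤y) sy<f with m≤n⇒m<n∨m≡n x≤y
  ... | inj₂ refl = step x sy<f
  ... | inj₁ x<y = <-trans (increasing x<y (<-trans (n<1+n y) sy<f)) (step y sy<f)

-- skip f shifts every x ≥ f up by one, so its image misses f; unskip f is
-- its inverse away from f.  They relabel [0, m) as [0, m+1) ∖ {f}.
skip : ℕ → ℕ → ℕ
skip f x with x <? f
... | yes _ = x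
... | no _ = suc x

unskip : ℕ → ℕ → ℕ
unskip f x with x <? f
... | yes _ = x
... | no _ = pred x

module _ {f : ℕ} where
  skip-below : ∀ {x} → x < f → skip f x ≡ x
  skip-below {x} p with x <? f
  ... | yes _ = refl
  ... | no q = contradiction p q

  skip-above : ∀ {x} → f ≤ x → skip f x ≡ suc x
  skip-above {x} p with x <? f
  ... | yes q = contradiction p (<⇒≱ q)
  ... | no _ = refl

  unskip-below : ∀ {x} → x < f → unskip f x ≡ x
  unskip-below {x} p with x <? f
  ... | yes _ = refl
  ... | no q = contradiction p q

  unskip-above : ∀ {x} → f ≤ x → unskip f x ≡ pred x
  unskip-above {x} p with x <? f
  ... | yes q = contradiction p (<⇒≱ q)
  ... | no _ = refl

  skip≢gap : ∀ x → skip f x ≢ f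
  skip≢gap x with x <? f
  ... | yes p = <⇒≢ p
  ... | no q = λ e → q (subst (x <_) e (n<1+n x))

  skip-mono : ∀ {x y} → x < y → skip f x < skip f y
  skip-mono {x} {y} x<y with x <? f | y <? f
  ... | yes _ | yes _ = x<y
  ... | yes _ | no _ = m<n⇒m<1+n x<y
  ... | no p | yes q = contradiction (<-trans x<y q) p
  ... | no _ | no _ = s≤s x<y

  skip-mono⁻ : ∀ {x y} → skip f x < skip f y → x < y
  skip-mono⁻ {x} {y} lt with <-cmp x y
  ... | tri< x<y _ _ = x<y
  ... | tri≈ _ refl _ = contradiction lt (n≮n _)
  ... | tri> _ _ y<x = contradiction (skip-mono y<x) (<-asym lt)

  unskip-skip : ∀ x → unskip f (skip f x) ≡ x
  unskip-skip x with x <? f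
  ... | yes p = unskip-below p
  ... | no q = unskip-above (≤-trans (≮⇒≥ q) (n≤1+n x))

  skip-unskip : ∀ {x} → x ≢ f → skip f (unskip f x) ≡ x
  skip-unskip {x} x≢f with <-cmp x f
  ... | tri< x<f _ _ = trans (cong (skip f) (unskip-below x<f)) (skip-below x<f)
  ... | tri≈ _ x≡f _ = contradiction x≡f x≢f
  ... | tri> _ _ f<x = trans (cong (skip f) (unskip-above (<⇒≤ f<x))) (skip-pred f<x)
    where
    skip-pred : ∀ {x} → f < x → skip f (pred x) ≡ x
    skip-pred {suc x} (s≤s f≤x) = skip-above f≤x

  skip<gap⁻ : ∀ {x} → skip f x < f → x < f
  skip<gap⁻ {x} p with x <? f
  ... | yes q = q
  ... | no _ = <-trans (n<1+n x) p

  skip<gap : ∀ {x} → x < f → skip f x < f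
  skip<gap p = subst (_< f) (sym (skip-below p)) p

  gap<skip : ∀ {x} → f ≤ x → f < skip f x
  gap<skip p = subst (f <_) (sym (skip-above p)) (s≤s p)

  skip-bound : ∀ {x m} → x < m → skip f x < suc m
  skip-bound {x} x<m with x <? f
  ... | yes _ = m<n⇒m<1+n x<m
  ... | no _ = s≤s x<m

  unskip-mono : ∀ {x y} → x ≢ f → y ≢ f → x < y → unskip f x < unskip f y
  unskip-mono x≢f y≢f x<y =
    skip-mono⁻ (subst₂ _<_ (sym (skip-unskip x≢f)) (sym (skip-unskip y≢f)) x<y)

  unskip-mono⁻ : ∀ {v w} → v ≢ f → w ≢ f → unskip f v < unskip f w → v < w
  unskip-mono⁻ v≢f w≢f lt = subst₂ _<_ (skip-unskip v≢f) (skip-unskip w≢f) (skip-mono lt)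

  unskip-bound : ∀ {m x} → f ≤ m → x < suc m → x ≢ f → unskip f x < m
  unskip-bound {m} {x} f≤m x<sm x≢f with <-cmp x f
  ... | tri< x<f _ _ = subst (_< m) (sym (unskip-below x<f)) (<-≤-trans x<f f≤m)
  ... | tri≈ _ x≡f _ = contradiction x≡f x≢f
  ... | tri> _ _ f<x = subst (_< m) (sym (unskip-above (<⇒≤ f<x))) (pred-bound f<x x<sm)
    where
    pred-bound : ∀ {x} → f < x → x < suc m → pred x < m
    pred-bound {suc x} _ (s≤s p) = p

-- extend f m h is the involution of [0, m+2) obtained from an involution h of
-- [0, m) by inserting the 2-cycle (f, m+1): positions and values are
-- relabelled by skip f, and the new last position is exchanged with f.
extend : ℕ → ℕ → (ℕ → ℕ) → ℕ → ℕ
extend f m h x with x ≟ suc m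
... | yes _ = f
... | no _ with x ≟ f
...   | yes _ = suc m
...   | no _ = skip f (h (unskip f x))

extend-last : ∀ f m h → extend f m h (suc m) ≡ f
extend-last f m h with suc m ≟ suc m
... | yes _ = refl
... | no q = contradiction refl q

extend-gap : ∀ f m h → f ≢ suc m → extend f m h f ≡ suc m
extend-gap f m h p with f ≟ suc m
... | yes q = contradiction q p
... | no _ with f ≟ f
...   | yes _ = refl
...   | no q = contradiction refl q

extend-other : ∀ f m h {x} → x ≢ suc m → x ≢ f → extend f m h x ≡ skip f (h (unskip f x))
extend-other f m h {x} p q with x ≟ suc m
... | yes r = contradiction r p
... | no _ with x ≟ f
...   | yes r = contradiction r q
...   | no _ = refl

data Position (f m x : ℕ) : Set where
  last  : x ≡ suc m → Position f m x
  gap   : x ≢ suc m → x ≡ f → Position f m x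
  other : x ≢ suc m → x ≢ f → Position f m x

position : ∀ f m x → Position f m x
position f m x with x ≟ suc m | x ≟ f
... | yes p | _     = last p
... | no p  | yes q = gap p q
... | no p  | no q  = other p q

extend-cong : ∀ f m h h' → f ≤ m → (∀ {y} → y < m → h y ≡ h' y) →
              ∀ {x} → x < suc (suc m) → extend f m h x ≡ extend f m h' x
extend-cong f m h h' f≤m h≈h' {x} x<n with position f m x
... | last refl = trans (extend-last f m h) (sym (extend-last f m h'))
... | gap x≢sm refl = trans (extend-gap f m h x≢sm) (sym (extend-gap f m h' x≢sm))
... | other x≢sm x≢f = begin
  extend f m h x              ≡⟨ extend-other f m h x≢sm x≢f ⟩
  skip f (h (unskip f x))     ≡⟨ cong (skip f) (h≈h' (unskip-bound f≤m (≤∧≢⇒< (≤-pred x<n) x≢sm) x≢f)) ⟩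
  skip f (h' (unskip f x))    ≡⟨ extend-other f m h' x≢sm x≢f ⟨
  extend f m h' x             ∎
  where open ≡-Reasoning

-- Extending a 213-avoiding involution h of [0, m) which increases on [0, f)
-- gives a 213-avoiding involution of [0, m+2).  The only new 213 patterns
-- would use the new values f or m+1; they are excluded because m+1 is the
-- maximum and h increases before the gap f.
module Extension {f m : ℕ} {h : ℕ → ℕ} (f≤m : f ≤ m) (I : Inv213 m h) (inc : IncreasingBelow f h) where
  G : ℕ → ℕ
  G = extend f m h

  f≢sm : f ≢ suc m
  f≢sm e = contradiction (subst (_≤ m) e f≤m) (n≮n m)

  G-last : G (suc m) ≡ f
  G-last = extend-last f m h

  G-gap : G f ≡ suc m
  G-gap = extend-gap f m h f≢sm

  G-other : ∀ {x} → x ≢ suc m → x ≢ f → G x ≡ skip f (h (unskip f x))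
  G-other = extend-other f m h

  unskip<m : ∀ {x} → x < suc (suc m) → x ≢ suc m → x ≢ f → unskip f x < m
  unskip<m x<n p q = unskip-bound f≤m (≤∧≢⇒< (≤-pred x<n) p) q

  G-below : ∀ {x} → x < f → G x ≡ skip f (h x)
  G-below x<f = trans (G-other (λ r → <-irrefl r (<-trans x<f (≤-<-trans f≤m (n<1+n m)))) (<⇒≢ x<f))
                      (cong (λ z → skip f (h z)) (unskip-below x<f))

  G-other<sm : ∀ {x} → x < suc (suc m) → x ≢ suc m → x ≢ f → G x < suc m
  G-other<sm x<n p q = subst (_< suc m) (sym (G-other p q)) (skip-bound (bounded I (unskip<m x<n p q)))

  G-bounded : ∀ {x} → x < suc (suc m) → G x < suc (suc m)
  G-bounded {x} x<n with position f m x
  ... | last refl = subst (_< suc (suc m)) (sym G-last) (s≤s (≤-trans f≤m (n≤1+n m)))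
  ... | gap _ refl = subst (_< suc (suc m)) (sym G-gap) ≤-refl
  ... | other p q = m<n⇒m<1+n (G-other<sm x<n p q)

  G-involutive : ∀ {x} → x < suc (suc m) → G (G x) ≡ x
  G-involutive {x} x<n with position f m x
  ... | last refl = trans (cong G G-last) G-gap
  ... | gap _ refl = trans (cong G G-gap) G-last
  ... | other p q = begin
      G (G x)                          ≡⟨ cong G (G-other p q) ⟩
      G y                              ≡⟨ G-other y≢sm (skip≢gap _) ⟩
      skip f (h (unskip f y))          ≡⟨ cong (λ z → skip f (h z)) (unskip-skip {f = f} (h u)) ⟩
      skip f (h (h u))                 ≡⟨ cong (skip f) (involutive I u<m) ⟩
      skip f u                         ≡⟨ skip-unskip q ⟩
      x                                ∎
    where
    open ≡-Reasoning
    u = unskip f x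
    u<m = unskip<m x<n p q
    y = skip f (h u)
    y≢sm : y ≢ suc m
    y≢sm eq = <-irrefl eq (skip-bound (bounded I u<m))

  -- A 213 pattern i < j < k in G: if i or j is the gap f, its value m+1 is
  -- too large; if k is the gap, i < j < f contradicts monotonicity of h;
  -- if k is the last position, the values h at unskip i < unskip j are below
  -- f and decreasing, so their images under h contradict monotonicity;
  -- otherwise the pattern comes from a 213 pattern of h.
  G-avoids : ∀ {i j k} → i < j → j < k → k < suc (suc m) → G j < G i → G i < G k → ⊥
  G-avoids {i} {j} {k} i<j j<k k<n Gj<Gi Gi<Gk
    with i ≟ f | j ≟ f
  ... | yes refl | _ = <⇒≱ (subst (_< G k) G-gap Gi<Gk) (≤-pred (G-bounded k<n))
  ... | no _ | yes refl = <⇒≱ (subst (_< G i) G-gap Gj<Gi) (≤-pred (G-bounded (<-trans i<j (<-trans j<k k<n))))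
  ... | no i≢f | no j≢f with position f m k
  ...   | gap _ refl = <-asym (skip-mono⁻ (subst₂ _<_ (G-below j<k) (G-below (<-trans i<j j<k)) Gj<Gi))
                              (inc i<j j<k)
  ...   | last refl = <-asym (inc hj<hi hi<f) (subst₂ _<_ (sym (involutive I ui<m)) (sym (involutive I uj<m)) ui<uj)
    where
    i≢sm = <⇒≢ (<-trans i<j j<k)
    j≢sm = <⇒≢ j<k
    ui<m = unskip<m (<-trans (<-trans i<j j<k) (n<1+n _)) i≢sm i≢f
    uj<m = unskip<m (<-trans j<k (n<1+n _)) j≢sm j≢f
    ui<uj = unskip-mono i≢f j≢f i<j
    hj<hi : h (unskip f j) < h (unskip f i)
    hj<hi = skip-mono⁻ (subst₂ _<_ (G-other j≢sm j≢f) (G-other i≢sm i≢f) Gj<Gi)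
    hi<f : h (unskip f i) < f
    hi<f = skip<gap⁻ (subst (_< f) (G-other i≢sm i≢f) (subst (G i <_) G-last Gi<Gk))
  ...   | other k≢sm k≢f = avoids I (unskip-mono i≢f j≢f i<j) (unskip-mono j≢f k≢f j<k) (unskip<m k<n k≢sm k≢f)
            (skip-mono⁻ (subst₂ _<_ (G-other j≢sm j≢f) (G-other i≢sm i≢f) Gj<Gi))
            (skip-mono⁻ (subst₂ _<_ (G-other i≢sm i≢f) (G-other k≢sm k≢f) Gi<Gk))
    where
    i≢sm = <⇒≢ (<-≤-trans (<-trans i<j j<k) (≤-pred k<n))
    j≢sm = <⇒≢ (<-≤-trans j<k (≤-pred k<n))

  extend-inv213 : Inv213 (suc (suc m)) G
  extend-inv213 = record { bounded = G-bounded ; involutive = G-involutive ; avoids = G-avoids }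

-- Conversely, a 213-avoiding involution g of [0, m+2) whose maximum sits at
-- a position f = g (m+1) ≤ m is the extension of its restriction g°: remove
-- the 2-cycle (f, m+1) and relabel by unskip f.  The restriction is again a
-- 213-avoiding involution, and it increases on [0, f) because g does.
module Restriction {m : ℕ} {g : ℕ → ℕ} (I : Inv213 (suc (suc m)) g) (f≤m : g (suc m) ≤ m) where
  open MaxValue I using (g-top; increasing-to-top)

  f : ℕ
  f = g (suc m)

  g° : ℕ → ℕ
  g° x = unskip f (g (skip f x))

  private
    n = suc (suc m)

    f<n : f < n
    f<n = s≤s (≤-trans f≤m (n≤1+n m))

    skip<n : ∀ {x} → x < m → skip f x < n
    skip<n x<m = m<n⇒m<1+n (skip-bound x<m)

    skip≢sm : ∀ {x} → x < m → skip f x ≢ suc m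
    skip≢sm x<m e = <-irrefl e (skip-bound x<m)

  value≢sm : ∀ {y} → y < n → y ≢ f → g y ≢ suc m
  value≢sm y<n y≢f e = y≢f (inv213-injective I y<n f<n (trans e (sym g-top)))

  value≢f : ∀ {y} → y < n → y ≢ suc m → g y ≢ f
  value≢f y<n y≢sm e = y≢sm (inv213-injective I y<n ≤-refl e)

  g-skip≢f : ∀ {x} → x < m → g (skip f x) ≢ f
  g-skip≢f x<m = value≢f (skip<n x<m) (skip≢sm x<m)

  g°-bounded : ∀ {x} → x < m → g° x < m
  g°-bounded x<m = unskip-bound f≤m
    (≤∧≢⇒< (≤-pred (bounded I (skip<n x<m))) (value≢sm (skip<n x<m) (skip≢gap _)))
    (g-skip≢f x<m)

  g°-involutive : ∀ {x} → x < m → g° (g° x) ≡ x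
  g°-involutive {x} x<m = begin
    unskip f (g (skip f (unskip f (g (skip f x))))) ≡⟨ cong (λ z → unskip f (g z)) (skip-unskip (g-skip≢f x<m)) ⟩
    unskip f (g (g (skip f x)))                     ≡⟨ cong (unskip f) (involutive I (skip<n x<m)) ⟩
    unskip f (skip f x)                             ≡⟨ unskip-skip {f = f} x ⟩
    x                                               ∎
    where open ≡-Reasoning

  g°-avoids : ∀ {i j k} → i < j → j < k → k < m → g° j < g° i → g° i < g° k → ⊥
  g°-avoids {i} {j} {k} i<j j<k k<m gj<gi gi<gk = avoids I (skip-mono i<j) (skip-mono j<k) (skip<n k<m)
     (unskip-mono⁻ (g-skip≢f j<m) (g-skip≢f i<m) gj<gi) (unskip-mono⁻ (g-skip≢f i<m) (g-skip≢f k<m) gi<gk)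
    where
    j<m = <-trans j<k k<m
    i<m = <-trans i<j j<m

  restrict-inv213 : Inv213 m g°
  restrict-inv213 = record { bounded = g°-bounded ; involutive = g°-involutive ; avoids = g°-avoids }

  restrict-increasing : IncreasingBelow f g°
  restrict-increasing {x} {y} x<y y<f =
    subst₂ _<_ (cong (λ z → unskip f (g z)) (sym (skip-below (<-trans x<y y<f))))
               (cong (λ z → unskip f (g z)) (sym (skip-below y<f)))
      (unskip-mono (value≢f x<n (λ e → <-irrefl e (<-trans x<f f<sm)))
                   (value≢f y<n (λ e → <-irrefl e (<-trans y<f f<sm)))
                   (increasing-to-top x<y (<⇒≤ y<f)))
    where
    f<sm = s≤s f≤m
    x<f = <-trans x<y y<f
    x<n = <-trans x<f f<n
    y<n = <-trans y<f f<n

  extend-restrict : ∀ {x} → x < n → g x ≡ extend f m g° x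
  extend-restrict {x} x<n with position f m x
  ... | last refl = sym (extend-last f m g°)
  ... | gap x≢sm refl = trans g-top (sym (extend-gap f m g° x≢sm))
  ... | other p q = sym (begin
    extend f m g° x                             ≡⟨ extend-other f m g° p q ⟩
    skip f (unskip f (g (skip f (unskip f x)))) ≡⟨ cong (λ z → skip f (unskip f (g z))) (skip-unskip q) ⟩
    skip f (unskip f (g x))                     ≡⟨ skip-unskip (value≢f x<n p) ⟩
    g x                                         ∎)
    where open ≡-Reasoning

  desWord-extend-restrict : desWord n g ≡ desWord n (extend f m g°)
  desWord-extend-restrict = descents-ext 0 (suc m) (λ x x≤ → extend-restrict (s≤s x≤))

-- The descent word of an extension.  The word reducedWord f u c is the
-- descent word of h when extend f m h has descent word 0^f 1 u c.
reducedWord : ℕ → List Bool → Bool → List Bool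
reducedWord f       u true  = replicate f false ++ u
reducedWord zero    u false = u
reducedWord (suc f) u false = replicate f false ++ true ∷ u

module ExtensionDescents {f m : ℕ} {h : ℕ → ℕ} (f≤m : f ≤ m) (I : Inv213 m h) (inc : IncreasingBelow f h) where
  open Extension f≤m I inc

  G-above : ∀ {x} → f < x → x ≤ m → G x ≡ skip f (h (pred x))
  G-above f<x x≤m = trans (G-other (λ r → <-irrefl r (s≤s x≤m)) (λ r → <-irrefl (sym r) f<x))
                          (cong (λ z → skip f (h z)) (unskip-above (<⇒≤ f<x)))

  -- no descent before the gap: G increases there and then reaches its maximum
  descentAt-below-gap : ∀ a → a < f → descentAt G a ≡ false
  descentAt-below-gap a a<f with m≤n⇒m<n∨m≡n a<f
  ... | inj₂ refl = descentAt-false {G} {a} (λ lt → <-asym (subst (_< G a) G-gap lt)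
                      (G-other<sm (<-trans a<f (s≤s (≤-trans f≤m (n≤1+n m))))
                                  (<⇒≢ (<-≤-trans a<f (≤-trans f≤m (n≤1+n m)))) (<⇒≢ a<f)))
  ... | inj₁ sa<f = descentAt-false {G} {a} (λ lt → <-asym (skip-mono (inc (n<1+n a) sa<f))
                      (subst₂ _<_ (G-below sa<f) (G-below (<-trans (n<1+n a) sa<f)) lt))

  -- the gap carries the maximum m+1, hence is followed by a descent
  descentAt-gap : descentAt G f ≡ true
  descentAt-gap = descentAt-true {G} {f} (subst (G (suc f) <_) (sym G-gap)
    (≤∧≢⇒< (≤-pred (G-bounded (s≤s (s≤s f≤m))))
           (λ e → <-irrefl (sym (inv213-injective extend-inv213 (s≤s (s≤s f≤m)) (s≤s (≤-trans f≤m (n≤1+n m)))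
                                                  (trans e (sym G-gap))))
                           (n<1+n f))))

  descentAt-middle : ∀ a → f < a → suc a ≤ m → descentAt G a ≡ descentAt h (pred a)
  descentAt-middle (suc a) f<a sa≤m = descentAt-cong {G} {h} {suc a} {a}
    (mk⇔ (λ lt → skip-mono⁻ (subst₂ _<_ G-next G-this lt))
         (λ lt → subst₂ _<_ (sym G-next) (sym G-this) (skip-mono lt)))
    where
    G-this : G (suc a) ≡ skip f (h a)
    G-this = G-above f<a (<⇒≤ sa≤m)
    G-next : G (suc (suc a)) ≡ skip f (h (suc a))
    G-next = G-above (<-trans f<a (n<1+n _)) sa≤m

  -- the last letter compares G m with G (m+1) = f: a descent iff the
  -- maximum of h lies at or after the gap
  descentAt-last : f < m → descentAt G m ≡ ⌊ f ≤? h (pred m) ⌋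
  descentAt-last f<m with f ≤? h (pred m)
  ... | yes f≤hm = descentAt-true {G} {m} (subst₂ _<_ (sym G-last) (sym G-m) (gap<skip f≤hm))
    where G-m = G-above f<m ≤-refl
  ... | no f≰hm = descentAt-false {G} {m}
                   (λ lt → <-asym (subst (_< f) (sym G-m) (skip<gap (≰⇒> f≰hm))) (subst (_< G m) G-last lt))
    where G-m = G-above f<m ≤-refl

desWord-increasing : ∀ n g → IncreasingBelow n g → desWord n g ≡ replicate (pred n) false
desWord-increasing n g inc = descents-ascending 0 (pred n)
  (λ a a<pn → descentAt-false {g} {a} (λ lt → <-asym lt (inc (n<1+n a) (suc<n n a<pn))))
  where
  suc<n : ∀ n {a} → a < pred n → suc a < n
  suc<n (suc n) p = s≤s p

extension-desWord-maximal : ∀ m h → Inv213 m h → IncreasingBelow m h →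
                            desWord (suc (suc m)) (extend m m h) ≡ replicate m false ++ true ∷ []
extension-desWord-maximal m h I inc = begin
  descents G 0 (suc m)                 ≡⟨ cong (descents G 0) (+-comm 1 m) ⟩
  descents G 0 (m + 1)                 ≡⟨ descents-++ G 0 m 1 ⟩
  descents G 0 m ++ descentAt G m ∷ [] ≡⟨ cong₂ (λ x y → x ++ y ∷ []) (descents-ascending 0 m descentAt-below-gap) descentAt-gap ⟩
  replicate m false ++ true ∷ []       ∎
  where
  open ≡-Reasoning
  open Extension ≤-refl I inc using (G)
  open ExtensionDescents ≤-refl I inc using (descentAt-below-gap; descentAt-gap)

-- For a gap f < m = f+k+1, the descent word of the extension is 0^f 1 u c,
-- where u is the run of descents of h after the gap and c records whether
-- the maximum of h lies at or after the gap.
extension-desWord : ∀ f k h → Inv213 (suc (f + k)) h → IncreasingBelow f h →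
  desWord (suc (suc (suc (f + k)))) (extend f (suc (f + k)) h)
    ≡ replicate f false ++ true ∷ (descents h f k ++ ⌊ f ≤? h (f + k) ⌋ ∷ [])
extension-desWord f k h I inc = begin
  descents G 0 (suc m)                                      ≡⟨ cong (descents G 0) m+1≡ ⟩
  descents G 0 (f + suc (suc k))                            ≡⟨ descents-++ G 0 f (suc (suc k)) ⟩
  descents G 0 f ++ descentAt G f ∷ descents G (suc f) (suc k)
    ≡⟨ cong₂ (λ x y → x ++ y ∷ descents G (suc f) (suc k)) (descents-ascending 0 f descentAt-below-gap) descentAt-gap ⟩
  replicate f false ++ true ∷ descents G (suc f) (suc k)    ≡⟨ cong (λ z → replicate f false ++ true ∷ descents G (suc f) z) (+-comm 1 k) ⟩
  replicate f false ++ true ∷ descents G (suc f) (k + 1)    ≡⟨ cong (λ z → replicate f false ++ true ∷ z) (descents-++ G (suc f) k 1) ⟩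
  replicate f false ++ true ∷ (descents G (suc f) k ++ descentAt G (suc f + k) ∷ [])
    ≡⟨ cong₂ (λ x y → replicate f false ++ true ∷ (x ++ y ∷ [])) middle (descentAt-last (s≤s (m≤m+n f k))) ⟩
  replicate f false ++ true ∷ (descents h f k ++ ⌊ f ≤? h (f + k) ⌋ ∷ []) ∎
  where
  open ≡-Reasoning
  m = suc (f + k)
  f≤m : f ≤ m
  f≤m = ≤-trans (m≤m+n f k) (n≤1+n _)
  open Extension f≤m I inc using (G)
  open ExtensionDescents f≤m I inc
  m+1≡ : suc m ≡ f + suc (suc k)
  m+1≡ = sym (trans (+-suc f (suc k)) (cong suc (+-suc f k)))
  middle : descents G (suc f) k ≡ descents h f k
  middle = descents-cong (suc f) f k
    (λ a a<k → descentAt-middle (suc (f + a)) (s≤s (m≤m+n f a)) (s≤s (+-monoʳ-< f a<k)))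

-- If the maximum of h lies at or after the gap f, h increases on [0, f].
restriction-desWord-ascent : ∀ f k h → Inv213 (suc (f + k)) h → f ≤ h (f + k) →
                             desWord (suc (f + k)) h ≡ replicate f false ++ descents h f k
restriction-desWord-ascent f k h I f≤top = trans (descents-++ h 0 f k)
  (cong (_++ descents h f k) (descents-ascending 0 f
    (λ a a<f → descentAt-false {h} {a} (λ lt → <-asym lt (increasing-to-top (n<1+n a) (≤-trans a<f f≤top))))))
  where open MaxValue I

-- If the maximum of h lies before the gap f+1, it lies exactly at f (h
-- increases on [0, f] and descends right after its maximum).
restriction-desWord-descent : ∀ f k h → Inv213 (suc (suc f + k)) h → IncreasingBelow (suc f) h →
                              h (suc f + k) < suc f →
                              desWord (suc (suc f + k)) h ≡ replicate f false ++ true ∷ descents h (suc f) k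
restriction-desWord-descent f k h I inc top<sf = begin
  descents h 0 (suc f + k)                                  ≡⟨ cong (descents h 0) (sym (+-suc f k)) ⟩
  descents h 0 (f + suc k)                                  ≡⟨ descents-++ h 0 f (suc k) ⟩
  descents h 0 f ++ descentAt h f ∷ descents h (suc f) k
    ≡⟨ cong₂ (λ x y → x ++ y ∷ descents h (suc f) k) before-top at-top ⟩
  replicate f false ++ true ∷ descents h (suc f) k          ∎
  where
  open ≡-Reasoning
  open MaxValue I
  sf<n : suc f < suc (suc f + k)
  sf<n = s≤s (s≤s (m≤m+n f k))
  top≡f : top ≡ f
  top≡f with m≤n⇒m<n∨m≡n (≤-pred top<sf)
  ... | inj₂ e = e
  ... | inj₁ top<f = ⊥-elim (<-asym (inc (n<1+n top) (s≤s top<f))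
                                    (descent-after-top (<-trans (s≤s top<f) sf<n)))
  before-top : descents h 0 f ≡ replicate f false
  before-top = descents-ascending 0 f
    (λ a a<f → descentAt-false {h} {a} (λ lt → <-asym lt (inc (n<1+n a) (s≤s a<f))))
  at-top : descentAt h f ≡ true
  at-top = descentAt-true {h} {f} (subst (λ z → h (suc z) < h z) top≡f
    (descent-after-top (subst (λ z → suc z < suc (suc f + k)) (sym top≡f) sf<n)))

restriction-desWord : ∀ f k h → Inv213 (suc (f + k)) h → IncreasingBelow f h →
  desWord (suc (f + k)) h ≡ reducedWord f (descents h f k) ⌊ f ≤? h (f + k) ⌋
restriction-desWord f k h I inc with f ≤? h (f + k)
... | yes f≤top = restriction-desWord-ascent f k h I f≤top
restriction-desWord zero    k h I inc | no 0≰top = contradiction z≤n 0≰top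
restriction-desWord (suc f) k h I inc | no f≰top = restriction-desWord-descent f k h I inc (≰⇒> f≰top)

positions : List Bool → List ℕ
positions [] = []
positions (true ∷ w) = 1 ∷ map suc (positions w)
positions (false ∷ w) = map suc (positions w)

SumAtLeast : ℕ → ℕ × ℕ → Set
SumAtLeast n p = n ≤ proj₁ p + proj₂ p

Balanced : ℕ → List ℕ → Set
Balanced n xs = All (SumAtLeast n) (zip xs (reverse xs))

positions-zeros-++ : ∀ f w → positions (replicate f false ++ w) ≡ map (f +_) (positions w)
positions-zeros-++ zero w = sym (map-id (positions w))
positions-zeros-++ (suc f) w = trans (cong (map suc) (positions-zeros-++ f w)) (sym (map-∘ (positions w)))

positions-snoc-true : ∀ w → positions (w ++ true ∷ []) ≡ positions w ++ suc (length w) ∷ []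
positions-snoc-true [] = refl
positions-snoc-true (true ∷ w) =
  trans (cong (λ z → 1 ∷ map suc z) (positions-snoc-true w)) (cong (1 ∷_) (map-++ suc (positions w) _))
positions-snoc-true (false ∷ w) = trans (cong (map suc) (positions-snoc-true w)) (map-++ suc (positions w) _)

positions-snoc-false : ∀ w → positions (w ++ false ∷ []) ≡ positions w
positions-snoc-false [] = refl
positions-snoc-false (true ∷ w) = cong (λ z → 1 ∷ map suc z) (positions-snoc-false w)
positions-snoc-false (false ∷ w) = cong (map suc) (positions-snoc-false w)

positions-bounded : ∀ w → All (_≤ length w) (positions w)
positions-bounded [] = []
positions-bounded (true ∷ w) = s≤s z≤n ∷ map⁺ (allMap s≤s (positions-bounded w))
positions-bounded (false ∷ w) = map⁺ (allMap s≤s (positions-bounded w))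

module _ (k : ℕ) (X : List ℕ) where
  private
    zip-shift : zip (map suc X) (reverse (map suc X)) ≡ map (Product.map suc suc) (zip X (reverse X))
    zip-shift = trans (cong (zip (map suc X)) (sym (reverse-map suc X))) (zip-map suc suc X (reverse X))

    raise : ∀ {x y} → SumAtLeast k (x , y) → SumAtLeast (suc (suc k)) (suc x , suc y)
    raise {x} {y} q = s≤s (subst (suc k ≤_) (sym (+-suc x y)) (s≤s q))

    lower : ∀ {x y} → SumAtLeast (suc (suc k)) (suc x , suc y) → SumAtLeast k (x , y)
    lower {x} {y} q = ≤-pred (subst (suc k ≤_) (+-suc x y) (≤-pred q))

  balanced-shift : Balanced k X → Balanced (suc (suc k)) (map suc X)
  balanced-shift p = subst (All (SumAtLeast (suc (suc k)))) (sym zip-shift) (map⁺ (allMap raise p))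

  balanced-shift⁻ : Balanced (suc (suc k)) (map suc X) → Balanced k X
  balanced-shift⁻ p = allMap lower (map⁻ (subst (All (SumAtLeast (suc (suc k)))) zip-shift p))

zip-++ : ∀ {A B : Set} (xs : List A) (ys : List B) {xs' ys'} → length xs ≡ length ys →
         zip (xs ++ xs') (ys ++ ys') ≡ zip xs ys ++ zip xs' ys'
zip-++ [] [] e = refl
zip-++ (x ∷ xs) (y ∷ ys) e = cong ((x , y) ∷_) (zip-++ xs ys (suc-injective e))

zip-peel : ∀ (a : ℕ) M b → zip (a ∷ M ++ b ∷ []) (reverse (a ∷ M ++ b ∷ []))
                          ≡ (a , b) ∷ (zip M (reverse M) ++ (b , a) ∷ [])
zip-peel a M b = trans (cong (zip (a ∷ M ++ b ∷ [])) reverse-peel)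
                       (cong ((a , b) ∷_) (zip-++ M (reverse M) (sym (length-reverse M))))
  where
  reverse-peel : reverse (a ∷ M ++ b ∷ []) ≡ b ∷ (reverse M ++ a ∷ [])
  reverse-peel = trans (unfold-reverse a (M ++ b ∷ [])) (cong (_∷ʳ a) (reverse-++ M (b ∷ [])))

balanced-peel : ∀ n a M b → n ≤ a + b → Balanced n M → Balanced n (a ∷ M ++ b ∷ [])
balanced-peel n a M b q ps = subst (All (SumAtLeast n)) (sym (zip-peel a M b))
  (q ∷ ++⁺ ps (subst (n ≤_) (+-comm a b) q ∷ []))

balanced-peel⁻ : ∀ n a M b → Balanced n (a ∷ M ++ b ∷ []) → Balanced n M
balanced-peel⁻ n a M b p with subst (All (SumAtLeast n)) (zip-peel a M b) p
... | _ ∷ qs = ++⁻ˡ (zip M (reverse M)) qs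

all-reverse : ∀ {P : ℕ → Set} {xs} → All P xs → All P (reverse xs)
all-reverse = go [] []
  where
  go : ∀ {P : ℕ → Set} {xs} acc → All P acc → All P xs → All P (reverseAcc acc xs)
  go acc pa [] = pa
  go acc pa (p ∷ ps) = go (_ ∷ acc) (p ∷ pa) ps

balanced-head : ∀ n B x xs → Balanced n (x ∷ xs) → All (_≤ B) (x ∷ xs) → n ≤ x + B
balanced-head n B x xs p bounds
  with reverse (x ∷ xs) | all-reverse bounds | length-reverse (x ∷ xs) | p
... | y ∷ _ | y≤B ∷ _ | _ | q ∷ _ = ≤-trans q (+-monoʳ-≤ x y≤B)

-- The last letter c of a word 0^f 1 u c can only be 0 when f > 0; this
-- holds for extensions (see restriction-desWord) and for balanced words.
Admissible : ℕ → Bool → Set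
Admissible f c = c ≡ false → 0 < f

admissible-last : ∀ f x → Admissible f ⌊ f ≤? x ⌋
admissible-last zero x e with 0 ≤? x
admissible-last zero x () | yes _
... | no 0≰x = contradiction z≤n 0≰x
admissible-last (suc f) x _ = s≤s z≤n

private
  shift-past : ∀ f X → map (f +_) (map suc X) ≡ map suc (map (f +_) X)
  shift-past f X = trans (sym (map-∘ X)) (trans (map-cong (λ x → +-suc f x) X) (map-∘ X))

positions-extension-true : ∀ f u →
  positions (replicate f false ++ true ∷ (u ++ true ∷ []))
    ≡ (f + 1) ∷ (map suc (positions (reducedWord f u true)) ++ (f + suc (suc (length u))) ∷ [])
positions-extension-true f u = begin
  positions (replicate f false ++ true ∷ (u ++ true ∷ []))
    ≡⟨ positions-zeros-++ f _ ⟩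
  map (f +_) (1 ∷ map suc (positions (u ++ true ∷ [])))
    ≡⟨ cong (λ z → map (f +_) (1 ∷ map suc z)) (positions-snoc-true u) ⟩
  (f + 1) ∷ map (f +_) (map suc (positions u ++ suc (length u) ∷ []))
    ≡⟨ cong (λ z → (f + 1) ∷ map (f +_) z) (map-++ suc (positions u) _) ⟩
  (f + 1) ∷ map (f +_) (map suc (positions u) ++ suc (suc (length u)) ∷ [])
    ≡⟨ cong ((f + 1) ∷_) (map-++ (f +_) (map suc (positions u)) _) ⟩
  (f + 1) ∷ (map (f +_) (map suc (positions u)) ++ (f + suc (suc (length u))) ∷ [])
    ≡⟨ cong (λ z → (f + 1) ∷ (z ++ (f + suc (suc (length u))) ∷ []))
            (trans (shift-past f (positions u)) (cong (map suc) (sym (positions-zeros-++ f u)))) ⟩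
  (f + 1) ∷ (map suc (positions (reducedWord f u true)) ++ (f + suc (suc (length u))) ∷ []) ∎
  where open ≡-Reasoning

positions-extension-false : ∀ f u →
  positions (replicate (suc f) false ++ true ∷ (u ++ false ∷ [])) ≡ map suc (positions (reducedWord (suc f) u false))
positions-extension-false f u = begin
  positions (replicate (suc f) false ++ true ∷ (u ++ false ∷ []))
    ≡⟨ positions-zeros-++ (suc f) _ ⟩
  map (suc f +_) (1 ∷ map suc (positions (u ++ false ∷ [])))
    ≡⟨ cong (λ z → map (suc f +_) (1 ∷ map suc z)) (positions-snoc-false u) ⟩
  map (suc f +_) (1 ∷ map suc (positions u))
    ≡⟨ map-∘ (1 ∷ map suc (positions u)) ⟩
  map suc (map (f +_) (1 ∷ map suc (positions u)))
    ≡⟨ cong (map suc) (sym (positions-zeros-++ f (true ∷ u))) ⟩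
  map suc (positions (reducedWord (suc f) u false)) ∎
  where open ≡-Reasoning

-- Balance of an extension word 0^f 1 u c at n = m+2 is equivalent to
-- balance of the reduced word at m: for c = 1 the outer pair (f+1, m+1)
-- sums to at least m+2, the remaining positions are shifted by one; for
-- c = 0 all positions are shifted by one.
balanced-extension : ∀ m f u c → suc (f + length u) ≡ m → Admissible f c →
  Balanced m (positions (reducedWord f u c)) →
  Balanced (suc (suc m)) (positions (replicate f false ++ true ∷ (u ++ c ∷ [])))
balanced-extension m f u true e _ p = subst (Balanced (suc (suc m))) (sym (positions-extension-true f u))
  (balanced-peel _ _ _ _ outer (balanced-shift m _ p))
  where
  m+1≡ : suc m ≡ f + suc (suc (length u))
  m+1≡ = sym (trans (+-suc f (suc (length u))) (cong suc (trans (+-suc f (length u)) e)))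
  outer : suc (suc m) ≤ (f + 1) + (f + suc (suc (length u)))
  outer = subst (λ z → suc (suc m) ≤ (f + 1) + z) m+1≡ (+-monoˡ-≤ (suc m) (m≤n+m 1 f))
balanced-extension m zero u false e adm p = contradiction (adm refl) (n≮n 0)
balanced-extension m (suc f) u false e _ p =
  subst (Balanced (suc (suc m))) (sym (positions-extension-false f u)) (balanced-shift m _ p)

balanced-extension⁻ : ∀ m f u c → Admissible f c →
  Balanced (suc (suc m)) (positions (replicate f false ++ true ∷ (u ++ c ∷ []))) →
  Balanced m (positions (reducedWord f u c))
balanced-extension⁻ m f u true _ p =
  balanced-shift⁻ m _ (balanced-peel⁻ _ _ _ _ (subst (Balanced (suc (suc m))) (positions-extension-true f u) p))
balanced-extension⁻ m zero u false adm p = contradiction (adm refl) (n≮n 0)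
balanced-extension⁻ m (suc f) u false _ p =
  balanced-shift⁻ m _ (subst (Balanced (suc (suc m))) (positions-extension-false f u) p)

balanced-single : ∀ m → Balanced (suc (suc m)) (positions (replicate m false ++ true ∷ []))
balanced-single m = subst (Balanced (suc (suc m))) (sym (positions-zeros-++ m (true ∷ []))) (twice ∷ [])
  where
  twice : suc (suc m) ≤ (m + 1) + (m + 1)
  twice = subst (λ z → suc z ≤ (m + 1) + (m + 1)) (+-comm m 1) (+-monoˡ-≤ (m + 1) (m≤n+m 1 m))

-- A balanced word 1 u 0 of length m+1 would pair position 1 with a
-- position ≤ m, so in a balanced word 0^f 1 u c the pair (f, c) is admissible.
balanced-admissible : ∀ m f u c → suc (f + length u) ≡ m →
  Balanced (suc (suc m)) (positions (replicate f false ++ true ∷ (u ++ c ∷ []))) → Admissible f c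
balanced-admissible m (suc f) u c e p _ = s≤s z≤n
balanced-admissible m zero u true e p ()
balanced-admissible m zero u false e p _ = contradiction too-short (<⇒≱ (s≤s (s≤s (≤-reflexive e))))
  where
  p' : Balanced (suc (suc m)) (1 ∷ map suc (positions u))
  p' = subst (Balanced (suc (suc m))) (cong (λ z → 1 ∷ map suc z) (positions-snoc-false u)) p
  too-short : suc (suc m) ≤ 1 + suc (length u)
  too-short = balanced-head _ (suc (length u)) 1 (map suc (positions u)) p' (positions-bounded (true ∷ u))

zeros≢zeros-one : ∀ a f v → replicate a false ≢ replicate f false ++ true ∷ v
zeros≢zeros-one zero    zero    v ()
zeros≢zeros-one zero    (suc f) v ()
zeros≢zeros-one (suc a) zero    v ()
zeros≢zeros-one (suc a) (suc f) v e = zeros≢zeros-one a f v (∷-injectiveʳ e)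

zeros-one-injective : ∀ f f' v v' → replicate f false ++ true ∷ v ≡ replicate f' false ++ true ∷ v' → f ≡ f' × v ≡ v'
zeros-one-injective zero    zero     v v' e = refl , ∷-injectiveʳ e
zeros-one-injective zero    (suc f') v v' ()
zeros-one-injective (suc f) zero     v v' ()
zeros-one-injective (suc f) (suc f') v v' e with zeros-one-injective f f' v v' (∷-injectiveʳ e)
... | refl , v≡v' = refl , v≡v'

zeros-then-zero≢one : ∀ f u u' → replicate (suc f) false ++ u ≢ replicate f false ++ true ∷ u'
zeros-then-zero≢one zero u u' ()
zeros-then-zero≢one (suc f) u u' e = zeros-then-zero≢one f u u' (∷-injectiveʳ e)

data LeadingZeros : List Bool → Set where
  zeros     : ∀ l → LeadingZeros (replicate l false)
  zeros-one : ∀ f v → LeadingZeros (replicate f false ++ true ∷ v)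

leadingZeros : ∀ w → LeadingZeros w
leadingZeros [] = zeros 0
leadingZeros (true ∷ w) = zeros-one 0 w
leadingZeros (false ∷ w) with leadingZeros w
... | zeros l = zeros (suc l)
... | zeros-one f v = zeros-one (suc f) v

reducedWord-length : ∀ f u c → Admissible f c → length (reducedWord f u c) ≡ f + length u
reducedWord-length f u true _ = trans (length-++ (replicate f false)) (cong (_+ length u) (length-replicate f))
reducedWord-length zero u false adm = contradiction (adm refl) (n≮n 0)
reducedWord-length (suc f) u false _ =
  trans (length-++ (replicate f false)) (trans (cong (_+ suc (length u)) (length-replicate f)) (+-suc f (length u)))

reducedWord-injective : ∀ f u u' c c' → Admissible f c → Admissible f c' →
                        reducedWord f u c ≡ reducedWord f u' c' → u ≡ u' × c ≡ c'
reducedWord-injective f u u' true true _ _ e = ++-cancelˡ (replicate f false) u u' e , refl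
reducedWord-injective zero u u' true false _ adm' e = contradiction (adm' refl) (n≮n 0)
reducedWord-injective zero u u' false c' adm _ e = contradiction (adm refl) (n≮n 0)
reducedWord-injective (suc f) u u' true false _ _ e = ⊥-elim (zeros-then-zero≢one f u u' e)
reducedWord-injective (suc f) u u' false true _ _ e = ⊥-elim (zeros-then-zero≢one f u' u (sym e))
reducedWord-injective (suc f) u u' false false _ _ e =
  ∷-injectiveʳ (++-cancelˡ (replicate f false) (true ∷ u) (true ∷ u') e) , refl

reducedWord-ascents : ∀ h l f u c → descents h 0 l ≡ reducedWord f u c → ∀ a → suc a < f → descentAt h a ≡ false
reducedWord-ascents h l f u true e a sa<f = descents-prefix 0 l f u e a (<-trans (n<1+n a) sa<f)
reducedWord-ascents h l (suc f) u false e a sa<f = descents-prefix 0 l f (true ∷ u) e a (≤-pred sa<f)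

desWord-fixed-top : ∀ {n' g} → Inv213 (suc n') g → g n' ≡ n' → desWord (suc n') g ≡ replicate n' false
desWord-fixed-top {n'} {g} I fixed = desWord-increasing (suc n') g
  (λ x<y y<n → increasing-to-top x<y (subst (_ ≤_) (sym fixed) (≤-pred y<n)))
  where open MaxValue I

desWord-moved-top : ∀ {n' g} → Inv213 (suc n') g → g n' < n' →
                    Σ (List Bool) λ v → desWord (suc n') g ≡ replicate (g n') false ++ true ∷ v
desWord-moved-top {n'} {g} I top<n' = descents g (suc top) j , (begin
  descents g 0 n'                                            ≡⟨ cong (descents g 0) n'≡ ⟩
  descents g 0 (top + suc j)                                 ≡⟨ descents-++ g 0 top (suc j) ⟩
  descents g 0 top ++ descentAt g top ∷ descents g (suc top) j ≡⟨ cong₂ (λ x y → x ++ y ∷ descents g (suc top) j) before at ⟩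
  replicate top false ++ true ∷ descents g (suc top) j       ∎)
  where
  open ≡-Reasoning
  open MaxValue I
  j = n' ∸ suc top
  n'≡ : n' ≡ top + suc j
  n'≡ = sym (trans (+-suc top j) (m+[n∸m]≡n top<n'))
  before : descents g 0 top ≡ replicate top false
  before = descents-ascending 0 top
    (λ a a<t → descentAt-false {g} {a} (λ lt → <-asym lt (increasing-to-top (n<1+n a) a<t)))
  at : descentAt g top ≡ true
  at = descentAt-true {g} {top} (descent-after-top (s≤s top<n'))

data GapView (f : ℕ) : ℕ → Set where
  last-gap  : GapView f f
  inner-gap : ∀ k → GapView f (suc (f + k))

gapView : ∀ {f m} → f ≤ m → GapView f m
gapView {f} f≤m with m≤n⇒m<n∨m≡n f≤m
... | inj₂ refl = last-gap
... | inj₁ (s≤s {n = m'} f≤m') = subst (λ z → GapView f (suc z)) (m+[n∸m]≡n f≤m') (inner-gap (m' ∸ f))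

extension-balanced : ∀ f m h → f ≤ m → Inv213 m h → IncreasingBelow f h →
  Balanced m (positions (desWord m h)) → Balanced (suc (suc m)) (positions (desWord (suc (suc m)) (extend f m h)))
extension-balanced f m h f≤m I inc bal with gapView f≤m
... | last-gap = subst (Balanced (suc (suc f)) ∘ positions) (sym (extension-desWord-maximal f h I inc)) (balanced-single f)
... | inner-gap k = subst (Balanced (suc (suc (suc (f + k)))) ∘ positions) (sym (extension-desWord f k h I inc))
        (balanced-extension (suc (f + k)) f (descents h f k) ⌊ f ≤? h (f + k) ⌋
          (cong (λ z → suc (f + z)) (descents-length h f k)) (admissible-last f _)
          (subst (Balanced (suc (f + k)) ∘ positions) (restriction-desWord f k h I inc) bal))

extension-desWord-injective : ∀ f m h h' → f ≤ m → Inv213 m h → Inv213 m h' →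
  IncreasingBelow f h → IncreasingBelow f h' →
  desWord (suc (suc m)) (extend f m h) ≡ desWord (suc (suc m)) (extend f m h') → desWord m h ≡ desWord m h'
extension-desWord-injective f m h h' f≤m I I' inc inc' e with gapView f≤m
... | last-gap = trans (desWord-increasing f h inc) (sym (desWord-increasing f h' inc'))
... | inner-gap k
  with ∷ʳ-injective _ _ (∷-injectiveʳ (++-cancelˡ (replicate f false) _ _
         (trans (sym (extension-desWord f k h I inc)) (trans e (extension-desWord f k h' I' inc')))))
...   | u≡u' , c≡c' = begin
  desWord (suc (f + k)) h                                  ≡⟨ restriction-desWord f k h I inc ⟩
  reducedWord f (descents h f k) ⌊ f ≤? h (f + k) ⌋        ≡⟨ cong₂ (reducedWord f) u≡u' c≡c' ⟩
  reducedWord f (descents h' f k) ⌊ f ≤? h' (f + k) ⌋      ≡⟨ restriction-desWord f k h' I' inc' ⟨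
  desWord (suc (f + k)) h'                                 ∎
  where open ≡-Reasoning

positions-zeros : ∀ l → positions (replicate l false) ≡ []
positions-zeros zero = refl
positions-zeros (suc l) = cong (map suc) (positions-zeros l)

-- Either the maximum is fixed (no descents at all), or g is the extension of
-- its restriction, whose descent word is balanced by induction.
desWord-balanced : ∀ n g → Inv213 n g → Balanced n (positions (desWord n g))
desWord-balanced zero g I = []
desWord-balanced (suc zero) g I = []
desWord-balanced (suc (suc m)) g I with m≤n⇒m<n∨m≡n (≤-pred (bounded I ≤-refl))
... | inj₂ fixed = subst (Balanced (suc (suc m)) ∘ positions) (sym (desWord-fixed-top I fixed))
                     (subst (Balanced (suc (suc m))) (sym (positions-zeros (suc m))) [])
... | inj₁ moved = subst (Balanced (suc (suc m)) ∘ positions) (sym desWord-extend-restrict)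
                     (extension-balanced f m g° (≤-pred moved) restrict-inv213 restrict-increasing
                       (desWord-balanced m g° restrict-inv213))
  where open Restriction I (≤-pred moved)

-- Injectivity: equal descent words force the maxima to sit at the same
-- position; then both involutions are extensions at the same gap, and their
-- restrictions agree by induction.
desWord-injective : ∀ n g k → Inv213 n g → Inv213 n k → desWord n g ≡ desWord n k → ∀ {x} → x < n → g x ≡ k x
desWord-injective zero g k _ _ _ ()
desWord-injective (suc zero) g k Ig Ik _ {zero} _ =
  trans (n<1⇒n≡0 (bounded Ig (s≤s z≤n))) (sym (n<1⇒n≡0 (bounded Ik (s≤s z≤n))))
desWord-injective (suc zero) g k _ _ _ {suc x} (s≤s ())
desWord-injective (suc (suc m)) g k Ig Ik e {x} x<n
  with m≤n⇒m<n∨m≡n (≤-pred (bounded Ig ≤-refl)) | m≤n⇒m<n∨m≡n (≤-pred (bounded Ik ≤-refl))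
... | inj₂ fixed-g | inj₂ fixed-k = trans (fixed-max⇒identity Ig fixed-g x<n) (sym (fixed-max⇒identity Ik fixed-k x<n))
... | inj₂ fixed-g | inj₁ moved-k = ⊥-elim (zeros≢zeros-one (suc m) _ _
      (trans (sym (desWord-fixed-top Ig fixed-g)) (trans e (proj₂ (desWord-moved-top Ik moved-k)))))
... | inj₁ moved-g | inj₂ fixed-k = ⊥-elim (zeros≢zeros-one (suc m) _ _
      (trans (sym (desWord-fixed-top Ik fixed-k)) (trans (sym e) (proj₂ (desWord-moved-top Ig moved-g)))))
... | inj₁ moved-g | inj₁ moved-k = begin
  g x                  ≡⟨ Rg.extend-restrict x<n ⟩
  extend f m Rg.g° x   ≡⟨ extend-cong f m Rg.g° Rk.g° f≤m restrictions-agree x<n ⟩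
  extend f m Rk.g° x   ≡⟨ k-extends x<n ⟨
  k x                  ∎
  where
  open ≡-Reasoning
  module Rg = Restriction Ig (≤-pred moved-g)
  module Rk = Restriction Ik (≤-pred moved-k)
  f = Rg.f
  f≤m = ≤-pred moved-g
  same-gap : Rk.f ≡ f
  same-gap = sym (proj₁ (zeros-one-injective _ _ _ _
    (trans (sym (proj₂ (desWord-moved-top Ig moved-g))) (trans e (proj₂ (desWord-moved-top Ik moved-k))))))
  k-extends : ∀ {y} → y < suc (suc m) → k y ≡ extend f m Rk.g° y
  k-extends {y} y<n = trans (Rk.extend-restrict y<n) (cong (λ z → extend z m Rk.g° y) same-gap)
  same-word : desWord (suc (suc m)) (extend f m Rg.g°) ≡ desWord (suc (suc m)) (extend f m Rk.g°)
  same-word = trans (sym Rg.desWord-extend-restrict) (trans e (descents-ext 0 (suc m) (λ y y≤ → k-extends (s≤s y≤))))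
  restrictions-agree : ∀ {y} → y < m → Rg.g° y ≡ Rk.g° y
  restrictions-agree = desWord-injective m Rg.g° Rk.g° Rg.restrict-inv213 Rk.restrict-inv213
    (extension-desWord-injective f m Rg.g° Rk.g° f≤m Rg.restrict-inv213 Rk.restrict-inv213
      Rg.restrict-increasing (subst (λ z → IncreasingBelow z Rk.g°) same-gap Rk.restrict-increasing) same-word)

length-zeros-one : ∀ f v → length (replicate f false ++ true ∷ v) ≡ suc (f + length v)
length-zeros-one f v =
  trans (length-++ (replicate f false)) (trans (cong (_+ suc (length v)) (length-replicate f)) (+-suc f (length v)))

-- If h realises the reduced word of 0^f 1 u c, the extension of h at the gap
-- f realises 0^f 1 u c itself: h increases on [0, f) because its word
-- starts with f-1 zeros, and the descent word of the extension is
-- determined by that of h (reducedWord f is injective).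
extension-realises : ∀ m f u c → m ≡ suc (f + length u) → Admissible f c →
  (Σ (ℕ → ℕ) λ h → Inv213 m h × desWord m h ≡ reducedWord f u c) →
  Σ (ℕ → ℕ) λ g → Inv213 (suc (suc m)) g × desWord (suc (suc m)) g ≡ replicate f false ++ true ∷ (u ++ c ∷ [])
extension-realises .(suc (f + length u)) f u c refl adm (h , I , eh) =
  extend f m h , Extension.extend-inv213 f≤m I inc , (begin
    desWord (suc (suc m)) (extend f m h)                                 ≡⟨ extension-desWord f k h I inc ⟩
    replicate f false ++ true ∷ (descents h f k ++ ⌊ f ≤? h (f + k) ⌋ ∷ []) ≡⟨ cong₂ (λ x y → replicate f false ++ true ∷ (x ++ y ∷ [])) u≡ c≡ ⟨
    replicate f false ++ true ∷ (u ++ c ∷ [])                            ∎)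
  where
  open ≡-Reasoning
  k = length u
  m = suc (f + k)
  f≤m : f ≤ m
  f≤m = ≤-trans (m≤m+n f k) (n≤1+n _)
  inc : IncreasingBelow f h
  inc = increasing-from-ascents I f f≤m (reducedWord-ascents h (f + k) f u c eh)
  same-letters : u ≡ descents h f k × c ≡ ⌊ f ≤? h (f + k) ⌋
  same-letters = reducedWord-injective f u (descents h f k) c _ adm (admissible-last f _)
                   (trans (sym eh) (restriction-desWord f k h I inc))
  u≡ = proj₁ same-letters
  c≡ = proj₂ same-letters

-- All-zero words come from the identity,
-- 0^m 1 from the extension of the identity at the last gap, and 0^f 1 u c
-- from the extension of an involution realising its (balanced) reduced word.
desWord-surjective : ∀ n w → length w ≡ pred n → Balanced n (positions w) →
                     Σ (ℕ → ℕ) λ g → Inv213 n g × desWord n g ≡ w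
desWord-surjective zero [] _ _ = (λ x → x) , id-inv213 0 , refl
desWord-surjective (suc zero) [] _ _ = (λ x → x) , id-inv213 1 , refl
desWord-surjective (suc (suc m)) w lw bal with leadingZeros w
... | zeros l = (λ x → x) , id-inv213 _ ,
      trans (desWord-increasing (suc (suc m)) (λ x → x) (λ x<y _ → x<y))
            (cong (λ z → replicate z false) (trans (sym lw) (length-replicate l)))
... | zeros-one f v with initLast v
...   | [] = extend m m (λ x → x) , Extension.extend-inv213 ≤-refl (id-inv213 m) (λ x<y _ → x<y) ,
             trans (extension-desWord-maximal m (λ x → x) (id-inv213 m) (λ x<y _ → x<y))
                   (cong (λ z → replicate z false ++ true ∷ []) (sym f≡m))
  where
  f≡m : f ≡ m
  f≡m = trans (sym (+-identityʳ f)) (suc-injective (trans (sym (length-zeros-one f [])) lw))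
...   | u ∷ʳ′ c = extension-realises m f u c m≡ adm
                    (desWord-surjective m (reducedWord f u c)
                      (trans (reducedWord-length f u c adm) (cong pred (sym m≡)))
                      (balanced-extension⁻ m f u c adm bal))
  where
  m≡ : m ≡ suc (f + length u)
  m≡ = begin
    m                             ≡⟨ suc-injective (trans (sym (length-zeros-one f _)) lw) ⟨
    f + length (u ++ c ∷ [])      ≡⟨ cong (f +_) (trans (length-++ u) (+-comm (length u) 1)) ⟩
    f + suc (length u)            ≡⟨ +-suc f (length u) ⟩
    suc (f + length u)            ∎
    where open ≡-Reasoning
  adm : Admissible f c
  adm = balanced-admissible m f u c (sym m≡) bal

toList-tabulate : ∀ {k} (e : Fin k → Bool) g s → (∀ a → e a ≡ descentAt g (s + toℕ a)) →
                  toList (tabulate e) ≡ descents g s k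
toList-tabulate {zero} e g s p = refl
toList-tabulate {suc k} e g s p = cong₂ _∷_ (trans (p Fin.zero) (cong (descentAt g) (+-identityʳ s)))
  (toList-tabulate (λ a → e (Fin.suc a)) g (suc s) (λ a → trans (p (Fin.suc a)) (cong (descentAt g) (+-suc s (toℕ a)))))

elems-positions : ∀ {k} (A : Subset k) → elems A ≡ positions (toList A)
elems-positions [] = refl
elems-positions (true ∷ A) = cong (λ z → 1 ∷ map suc z) (elems-positions A)
elems-positions (false ∷ A) = cong (map suc) (elems-positions A)

InG⇒Balanced : ∀ n {k} (A : Subset k) → InG n A → Balanced n (positions (toList A))
InG⇒Balanced n A p = subst (Balanced n) (elems-positions A) (allMap (λ { {x , y} q → q }) p)

Balanced⇒InG : ∀ n {k} (A : Subset k) → Balanced n (positions (toList A)) → InG n A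
Balanced⇒InG n A p = allMap (λ { {x , y} q → q }) (subst (Balanced n) (sym (elems-positions A)) p)

module AsFunction {m : ℕ} (ι : Perm (suc m)) where
  fun : ℕ → ℕ
  fun x with x <? suc m
  ... | yes p = toℕ (ι ⟨$⟩ʳ fromℕ< p)
  ... | no _ = x

  fun-toℕ : ∀ (i : Fin (suc m)) → fun (toℕ i) ≡ toℕ (ι ⟨$⟩ʳ i)
  fun-toℕ i with toℕ i <? suc m
  ... | yes p = cong (λ z → toℕ (ι ⟨$⟩ʳ z)) (fromℕ<-toℕ i p)
  ... | no q = contradiction (toℕ<n i) q

  fun-fromℕ< : ∀ {x} (p : x < suc m) → fun x ≡ toℕ (ι ⟨$⟩ʳ fromℕ< p)
  fun-fromℕ< {x} p = subst (λ z → fun z ≡ toℕ (ι ⟨$⟩ʳ fromℕ< p)) (toℕ-fromℕ< p) (fun-toℕ (fromℕ< p))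

  fun-inv213 : IsInvolution ι → Avoids213 ι → Inv213 (suc m) fun
  fun-inv213 inv avoid = record { bounded = fun-bounded ; involutive = fun-involutive ; avoids = fun-avoids }
    where
    fun-bounded : ∀ {x} → x < suc m → fun x < suc m
    fun-bounded p = subst (_< suc m) (sym (fun-fromℕ< p)) (toℕ<n _)
    fun-involutive : ∀ {x} → x < suc m → fun (fun x) ≡ x
    fun-involutive {x} p = begin
      fun (fun x)                              ≡⟨ cong fun (fun-fromℕ< p) ⟩
      fun (toℕ (ι ⟨$⟩ʳ fromℕ< p))              ≡⟨ fun-toℕ (ι ⟨$⟩ʳ fromℕ< p) ⟩
      toℕ (ι ⟨$⟩ʳ (ι ⟨$⟩ʳ fromℕ< p))           ≡⟨ cong toℕ (inv (fromℕ< p)) ⟩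
      toℕ (fromℕ< p)                           ≡⟨ toℕ-fromℕ< p ⟩
      x                                        ∎
      where open ≡-Reasoning
    fun-avoids : ∀ {i j k} → i < j → j < k → k < suc m → fun j < fun i → fun i < fun k → ⊥
    fun-avoids {i} {j} {k} i<j j<k k<n fj<fi fi<fk = avoid
      (fromℕ< i<n , fromℕ< j<n , fromℕ< k<n ,
       subst₂ _<_ (sym (toℕ-fromℕ< i<n)) (sym (toℕ-fromℕ< j<n)) i<j ,
       subst₂ _<_ (sym (toℕ-fromℕ< j<n)) (sym (toℕ-fromℕ< k<n)) j<k ,
       subst₂ _<_ (fun-fromℕ< j<n) (fun-fromℕ< i<n) fj<fi ,
       subst₂ _<_ (fun-fromℕ< i<n) (fun-fromℕ< k<n) fi<fk)
      where
      j<n = <-trans j<k k<n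
      i<n = <-trans i<j j<n

  Des-desWord : toList (Des ι) ≡ desWord (suc m) fun
  Des-desWord = toList-tabulate _ fun 0 (λ a → cong₂ (λ x y → ⌊ x <? y ⌋)
    (sym (fun-toℕ (Fin.suc a))) (sym (trans (cong fun (sym (toℕ-inject₁ a))) (fun-toℕ (inject₁ a)))))

module AsPerm {m : ℕ} {g : ℕ → ℕ} (I : Inv213 (suc m) g) where
  on-Fin : Fin (suc m) → Fin (suc m)
  on-Fin i = fromℕ< (bounded I (toℕ<n i))

  toℕ-on-Fin : ∀ i → toℕ (on-Fin i) ≡ g (toℕ i)
  toℕ-on-Fin i = toℕ-fromℕ< _

  on-Fin-involutive : ∀ i → on-Fin (on-Fin i) ≡ i
  on-Fin-involutive i = toℕ-injective
    (trans (toℕ-on-Fin (on-Fin i)) (trans (cong g (toℕ-on-Fin i)) (involutive I (toℕ<n i))))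

  ι : Perm (suc m)
  ι = permutation on-Fin on-Fin on-Fin-involutive on-Fin-involutive

  ι-involution : IsInvolution ι
  ι-involution = on-Fin-involutive

  ι-avoids : Avoids213 ι
  ι-avoids (i , j , k , i<j , j<k , ιj<ιi , ιi<ιk) = avoids I i<j j<k (toℕ<n k)
    (subst₂ _<_ (toℕ-on-Fin j) (toℕ-on-Fin i) ιj<ιi) (subst₂ _<_ (toℕ-on-Fin i) (toℕ-on-Fin k) ιi<ιk)

  Des-ι : toList (Des ι) ≡ desWord (suc m) g
  Des-ι = trans Des-desWord (descents-ext 0 m (λ x x≤m → agrees (s≤s x≤m)))
    where
    open AsFunction ι using (fun; fun-fromℕ<; Des-desWord)
    agrees : ∀ {x} → x < suc m → fun x ≡ g x
    agrees p = trans (fun-fromℕ< p) (trans (toℕ-on-Fin _) (cong g (toℕ-fromℕ< p)))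

Des-in-G : ∀ m (ι : Perm (suc m)) → IsInvolution ι → Avoids213 ι → InG (suc m) (Des ι)
Des-in-G m ι inv avoid = Balanced⇒InG (suc m) (Des ι)
  (subst (Balanced (suc m) ∘ positions) (sym Des-desWord) (desWord-balanced (suc m) fun (fun-inv213 inv avoid)))
  where open AsFunction ι

Des-injective : ∀ m (ι κ : Perm (suc m)) → IsInvolution ι → Avoids213 ι → IsInvolution κ → Avoids213 κ →
                Des ι ≡ Des κ → ∀ i → ι ⟨$⟩ʳ i ≡ κ ⟨$⟩ʳ i
Des-injective m ι κ inv-ι avoid-ι inv-κ avoid-κ e i = toℕ-injective (begin
  toℕ (ι ⟨$⟩ʳ i)   ≡⟨ Fι.fun-toℕ i ⟨
  Fι.fun (toℕ i)   ≡⟨ desWord-injective (suc m) Fι.fun Fκ.fun (Fι.fun-inv213 inv-ι avoid-ι) (Fκ.fun-inv213 inv-κ avoid-κ)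
                        (trans (sym Fι.Des-desWord) (trans (cong toList e) Fκ.Des-desWord)) (toℕ<n i) ⟩
  Fκ.fun (toℕ i)   ≡⟨ Fκ.fun-toℕ i ⟩
  toℕ (κ ⟨$⟩ʳ i)   ∎)
  where
  open ≡-Reasoning
  module Fι = AsFunction ι
  module Fκ = AsFunction κ

Des-surjective : ∀ m (A : Subset m) → InG (suc m) A → ∃[ ι ] (IsInvolution ι × Avoids213 ι × Des ι ≡ A)
Des-surjective m A A∈G with desWord-surjective (suc m) (toList A) (length-toList A) (InG⇒Balanced (suc m) A A∈G)
... | g , I , realises = ι , ι-involution , ι-avoids ,
      trans (sym (cast-is-id refl (Des ι))) (toList-injective refl (Des ι) A (trans Des-ι realises))
  where open AsPerm I

lemma4p10 : (m : ℕ) →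
    (∀ (ι : Perm (suc m)) → IsInvolution ι → Avoids213 ι → InG (suc m) (Des ι))
    × (∀ (ι κ : Perm (suc m)) → IsInvolution ι → Avoids213 ι
         → IsInvolution κ → Avoids213 κ → Des ι ≡ Des κ → ∀ i → ι ⟨$⟩ʳ i ≡ κ ⟨$⟩ʳ i)
    × (∀ (A : Subset m) → InG (suc m) A
         → ∃[ ι ] (IsInvolution ι × Avoids213 ι × Des ι ≡ A))
lemma4p10 m = Des-in-G m , Des-injective m , Des-surjective m
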